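{- Let $r<n$ be positive integers and $\delta\in(0,1)$. There is a classical-model streaming algorithm that solves $\mathrm{MIF}(n,r)$ with error at most $\delta$ on every fixed input stream and uses $s \le \min\left(r, \frac{\log(1/\delta)}{\log(n/r)}\right)$ bits of space, assuming oracle access to $O((s+1)\log n)$ random bits. (Concretely: with $t=\min(r,\lfloor \log(1/\delta)/\log(n/r)\rfloor)$, choose a uniformly random sequence $L_1,\ldots,L_{t+1}$ of distinct elements of $[n]$ from the random oracle; maintain a bit vector $x\in\{0,1\}^t$ with $x_j=1$ iff $L_j$ has appeared in the stream; output $L_j$ for some $j\in[t]$ with $x_j=0$ if one exists, and otherwise $L_{t+1}$.)
   Context: For integers $r<n$, $\mathrm{MIF}(n,r)$ (Missing Item Finding): given a stream $a_1,\ldots,a_r\in[n]$ (repetitions allowed), output some $x\in[n]$ with $x\ne a_i$ for all $i$. In the classical model, the streaming algorithm's initial state, transitions and output may depend on a shared random variable (random oracle) whose bits are not counted in the space; the space is $\lceil\log_2|\Sigma|\rceil$ bits where $\Sigma$ is the set of states; the error is the maximum, over fixed input streams in $[n]^r$, of the probability that the output at the end of the stream is incorrect. Logarithms are base 2.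
   Formalization: The error parameter δ ranges over the rationals in (0,1). -}

module Defs where

open import Data.Nat using (ℕ; suc; _^_)
open import Data.Fin using (Fin)
import Data.Fin as Fin
open import Data.Vec using (Vec; foldl)
open import Data.Vec.Membership.Propositional using (_∈_)
import Data.Vec.Membership.DecPropositional as DecMem
open import Data.List using (List; length; filter)
open import Data.List.Base using () renaming (allFin to allFinL)
open import Data.Integer using (+_)
open import Data.Rational using (ℚ; _/_)

-- A streaming algorithm for streams over [n] = Fin n, in the classical model,
-- using s bits of space: its state set is Σ = Fin (2 ^ s) (so ⌈log₂|Σ|⌉ ≤ s),
-- and initial state, transitions and output all depend on the shared
-- random value ω : R (the random oracle, whose bits are not counted in space).
record StreamAlg (n s : ℕ) (R : Set) : Set where
  field
    init : R → Fin (2 ^ s)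
    step : R → Fin (2 ^ s) → Fin n → Fin (2 ^ s)
    out  : R → Fin (2 ^ s) → Fin n

open StreamAlg public

finalState : ∀ {n s r R} → StreamAlg n s R → R → Vec (Fin n) r → Fin (2 ^ s)
finalState A ω xs = foldl _ (step A ω) (init A ω) xs

output : ∀ {n s r R} → StreamAlg n s R → R → Vec (Fin n) r → Fin n
output A ω xs = out A ω (finalState A ω xs)

Fails : ∀ {n s r R} → StreamAlg n s R → Vec (Fin n) r → R → Set
Fails A xs ω = output A ω xs ∈ xs

-- Random oracle: uniform on Fin (suc k) (log₂ (suc k) random bits).
-- Number of oracle values on which the algorithm errs on the stream xs.
failCount : ∀ {n s r k} → StreamAlg n s (Fin (suc k)) → Vec (Fin n) r → ℕ
failCount {n = n} {k = k} A xs =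
  length (filter (λ ω → DecMem._∈?_ (Fin._≟_ {n}) (output A ω xs) xs) (allFinL (suc k)))

errorProb : ∀ {n s r k} → StreamAlg n s (Fin (suc k)) → Vec (Fin n) r → ℚ
errorProb {k = k} A xs = (+ failCount A xs) / suc k

{-# OPTIONS --safe #-}
-- The algorithm keeps one "seen" bit for each of t candidate labels and answers the
-- first unseen candidate, or a fallback label if all have been seen, so it can only err
-- when all t + 1 labels occur in the stream. With t = r and r + 1 distinct labels this
-- is impossible by pigeonhole, and no randomness is needed. Otherwise the labels form a
-- uniformly random tuple in [n]^(t+1), and all of them lie among the at most r stream
-- values with probability at most (r/n)^(t+1); choosing t as the largest s ≤ r with
-- δ (n/r)^s ≤ 1 makes this less than δ unless t = r.
module Submission where

open import Defs
open import Data.Nat using (ℕ; zero; suc; pred; _+_; _*_; _^_; _<_; _≤_; z≤n; s≤s; NonZero; ≢-nonZero)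
import Data.Nat.Properties as ℕ
open import Data.Fin using (Fin; zero; suc; combine; remQuot; _↑ˡ_; _↑ʳ_; inject≤; _≟_)
import Data.Fin.Properties as Fin
open import Data.Vec using (Vec; []; _∷_; foldl; map; replicate; tabulate; lookup; head; tail)
import Data.Vec.Properties as Vec
open import Data.Vec.Membership.Propositional using (_∈_)
import Data.Vec.Membership.DecPropositional as DecMembership
import Data.Vec.Relation.Unary.Any as Any
open import Data.Vec.Relation.Unary.Any.Properties using (lookup-index)
open import Data.List using (length; filter)
import Data.List as List
open import Data.Bool using (Bool; true; false; _∧_; _∨_; T; if_then_else_)
import Data.Bool.Properties as Bool
open import Data.Product using (Σ; _×_; _,_; proj₁; proj₂)
open import Data.Sum using (_⊎_; inj₁; inj₂)
open import Data.Empty using (⊥-elim)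
open import Data.Integer as ℤ using (+_)
import Data.Integer.Properties as ℤ
open import Data.Rational using (ℚ; mkℚ; _/_; 0ℚ; 1ℚ) renaming (_<_ to _<ℚ_; _≤_ to _≤ℚ_; _*_ to _*ℚ_)
import Data.Rational.Properties as ℚ
open import Data.Rational.Unnormalised using (mkℚᵘ; *≤*) renaming (_<_ to _<ᵘ_; _*_ to _*ᵘ_)
import Data.Rational.Unnormalised.Properties as ℚᵘ
open import Function using (_∘_; const)
open import Function.Definitions using (Injective)
open import Function.Bundles using (Equivalence; Inverse)
open import Relation.Nullary using (Dec; yes; no; does; ¬_)
open import Relation.Unary using (Pred; Decidable)
open import Relation.Binary.PropositionalEquality

_∈ᵇ_ : ∀ {n m} → Fin n → Vec (Fin n) m → Bool
x ∈ᵇ xs = does (DecMembership._∈?_ _≟_ x xs)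

count : ∀ N → (Fin N → Bool) → ℕ
count zero    p = 0
count (suc N) p = if p zero then suc (count N (p ∘ suc)) else count N (p ∘ suc)

length-filter-tabulate : ∀ {a ℓ} {A : Set a} {P : Pred A ℓ} (P? : Decidable P) N (g : Fin N → A) →
  length (filter P? (List.tabulate g)) ≡ count N (does ∘ P? ∘ g)
length-filter-tabulate P? zero    g = refl
length-filter-tabulate P? (suc N) g with does (P? (g zero))
... | true  = cong suc (length-filter-tabulate P? N (g ∘ suc))
... | false = length-filter-tabulate P? N (g ∘ suc)

count-cong : ∀ {N} {p q : Fin N → Bool} → (∀ i → p i ≡ q i) → count N p ≡ count N q
count-cong {zero}  p≗q = refl
count-cong {suc N} {p} {q} p≗q rewrite p≗q zero | count-cong {N} {p ∘ suc} {q ∘ suc} (p≗q ∘ suc) = refl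

count-mono : ∀ {N} {p q : Fin N → Bool} → (∀ i → T (p i) → T (q i)) → count N p ≤ count N q
count-mono {zero} p⇒q = z≤n
count-mono {suc N} {p} {q} p⇒q with p zero | q zero | p⇒q zero
... | false | false | _  = count-mono (p⇒q ∘ suc)
... | false | true  | _  = ℕ.m≤n⇒m≤1+n (count-mono (p⇒q ∘ suc))
... | true  | true  | _  = s≤s (count-mono (p⇒q ∘ suc))
... | true  | false | p₀⇒q₀ = ⊥-elim (p₀⇒q₀ _)

count-false : ∀ N → count N (const false) ≡ 0
count-false zero    = refl
count-false (suc N) = count-false N

count-∨ : ∀ {N} (p q : Fin N → Bool) → count N (λ i → p i ∨ q i) ≤ count N p + count N q
count-∨ {zero}  p q = z≤n
count-∨ {suc N} p q with p zero | q zero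
... | false | false = count-∨ (p ∘ suc) (q ∘ suc)
... | false | true  = ℕ.≤-trans (s≤s (count-∨ (p ∘ suc) (q ∘ suc))) (ℕ.≤-reflexive (sym (ℕ.+-suc _ _)))
... | true  | false = s≤s (count-∨ (p ∘ suc) (q ∘ suc))
... | true  | true  =
  s≤s (ℕ.≤-trans (count-∨ (p ∘ suc) (q ∘ suc)) (ℕ.+-monoʳ-≤ (count N (p ∘ suc)) (ℕ.n≤1+n _)))

count-≟ : ∀ {N} (x : Fin N) → count N (λ i → does (i ≟ x)) ≡ 1
count-≟ {suc N} zero    = cong suc (count-false N)
count-≟ {suc N} (suc x) = count-≟ x

count-∈ : ∀ {N m} (xs : Vec (Fin N) m) → count N (_∈ᵇ xs) ≤ m
count-∈ {N} []       = ℕ.≤-reflexive (count-false N)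
count-∈ {N} (x ∷ xs) = ℕ.≤-trans (count-∨ (λ i → does (i ≟ x)) (_∈ᵇ xs))
  (ℕ.+-mono-≤ (ℕ.≤-reflexive (count-≟ x)) (count-∈ xs))

count-↑ : ∀ a b (p : Fin (a + b) → Bool) →
  count (a + b) p ≡ count a (p ∘ (_↑ˡ b)) + count b (p ∘ (a ↑ʳ_))
count-↑ zero    b p = refl
count-↑ (suc a) b p with p zero
... | true  = cong suc (count-↑ a b (p ∘ suc))
... | false = count-↑ a b (p ∘ suc)

count-combine : ∀ n N (h : Fin (n * N) → Bool) (f : Fin n → Bool) (g : Fin N → Bool) →
  (∀ a j → h (combine a j) ≡ f a ∧ g j) → count (n * N) h ≡ count n f * count N g
count-combine zero    N h f g h≡ = refl
count-combine (suc n) N h f g h≡ with f zero | h≡ zero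
... | true  | h₀ = trans (count-↑ N (n * N) h)
  (cong₂ _+_ (count-cong h₀) (count-combine n N _ (f ∘ suc) g (h≡ ∘ suc)))
... | false | h₀ = trans (count-↑ N (n * N) h)
  (cong₂ _+_ (trans (count-cong h₀) (count-false N)) (count-combine n N _ (f ∘ suc) g (h≡ ∘ suc)))

count-subst : ∀ {a b} (a≡b : a ≡ b) (p : Fin b → Bool) → count a (p ∘ subst Fin a≡b) ≡ count b p
count-subst refl p = refl

decode : ∀ {n} m → Fin (n ^ m) → Vec (Fin n) m
decode         zero    _ = []
decode {n = n} (suc m) x = proj₁ (remQuot {n} (n ^ m) x) ∷ decode m (proj₂ (remQuot {n} (n ^ m) x))

encode : ∀ {n m} → Vec (Fin n) m → Fin (n ^ m)
encode []       = zero
encode (a ∷ as) = combine a (encode as)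

decode-encode : ∀ {n m} (as : Vec (Fin n) m) → decode m (encode as) ≡ as
decode-encode []                 = refl
decode-encode {n} {suc m} (a ∷ as) = trans
  (cong (λ (b , y) → b ∷ decode m y) (Fin.remQuot-combine {n} {n ^ m} a (encode as)))
  (cong (a ∷_) (decode-encode as))

allᵇ : ∀ {A : Set} {m} → (A → Bool) → Vec A m → Bool
allᵇ p []       = true
allᵇ p (x ∷ xs) = p x ∧ allᵇ p xs

count-allᵇ-decode : ∀ n m (p : Fin n → Bool) → count (n ^ m) (allᵇ p ∘ decode m) ≡ count n p ^ m
count-allᵇ-decode n zero    p = refl
count-allᵇ-decode n (suc m) p = trans
  (count-combine n (n ^ m) _ p (allᵇ p ∘ decode m)
    (λ a y → cong (λ (b , z) → p b ∧ allᵇ p (decode m z)) (Fin.remQuot-combine {n} {n ^ m} a y)))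
  (cong (count n p *_) (count-allᵇ-decode n m p))

T-allᵇ-tabulate : ∀ {A : Set} {m} (p : A → Bool) (f : Fin m → A) →
  T (allᵇ p (tabulate f)) → ∀ i → T (p (f i))
T-allᵇ-tabulate p f all zero    = proj₁ (Equivalence.to Bool.T-∧ all)
T-allᵇ-tabulate p f all (suc i) = T-allᵇ-tabulate p (f ∘ suc) (proj₂ (Equivalence.to Bool.T-∧ all)) i

∈ᵇ⇒∈ : ∀ {n m} {x : Fin n} {xs : Vec (Fin n) m} → T (x ∈ᵇ xs) → x ∈ xs
∈ᵇ⇒∈ {x = x} {xs} with DecMembership._∈?_ _≟_ x xs
... | yes x∈xs = const x∈xs
... | no  _    = λ ()

injective⇒⊈ : ∀ {A : Set} {m} (f : Fin (suc m) → A) → Injective _≡_ _≡_ f →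
  (xs : Vec A m) → ¬ (∀ i → f i ∈ xs)
injective⇒⊈ f f-injective xs f⊆xs
  with i , j , i<j , same-index ← Fin.pigeonhole (ℕ.n<1+n _) (Any.index ∘ f⊆xs)
  = Fin.<-irrefl (f-injective fi≡fj) i<j
  where
  open ≡-Reasoning
  fi≡fj : f i ≡ f j
  fi≡fj = begin
    f i                            ≡⟨ lookup-index (f⊆xs i) ⟩
    lookup xs (Any.index (f⊆xs i)) ≡⟨ cong (lookup xs) same-index ⟩
    lookup xs (Any.index (f⊆xs j)) ≡⟨ lookup-index (f⊆xs j) ⟨
    f j                            ∎

encodeBits : ∀ {s} → Vec Bool s → Fin (2 ^ s)
encodeBits = encode ∘ map (Inverse.from Fin.2↔Bool)

decodeBits : ∀ {s} → Fin (2 ^ s) → Vec Bool s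
decodeBits {s} = map (Inverse.to Fin.2↔Bool) ∘ decode s

decodeBits-encodeBits : ∀ {s} (bs : Vec Bool s) → decodeBits (encodeBits bs) ≡ bs
decodeBits-encodeBits bs = begin
  map to (decode _ (encode (map from bs))) ≡⟨ cong (map to) (decode-encode (map from bs)) ⟩
  map to (map from bs)                     ≡⟨ Vec.map-∘ to from bs ⟨
  map (to ∘ from) bs                       ≡⟨ Vec.map-cong (Inverse.strictlyInverseˡ Fin.2↔Bool) bs ⟩
  map (λ b → b) bs                         ≡⟨ Vec.map-id bs ⟩
  bs                                       ∎
  where open Inverse Fin.2↔Bool using (to; from); open ≡-Reasoning

markSeen : ∀ {n t} → Fin n → Vec (Fin n) t → Vec Bool t → Vec Bool t
markSeen a []       []       = []
markSeen a (l ∷ ls) (b ∷ bs) = (b ∨ does (l ≟ a)) ∷ markSeen a ls bs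

markSeen-map : ∀ {n t} a (p : Fin n → Bool) (ls : Vec (Fin n) t) →
  markSeen a ls (map p ls) ≡ map (λ l → p l ∨ does (l ≟ a)) ls
markSeen-map a p []       = refl
markSeen-map a p (l ∷ ls) = cong (_ ∷_) (markSeen-map a p ls)

firstUnseen : ∀ {n t} → Vec (Fin n) t → Vec Bool t → Fin n → Fin n
firstUnseen []       []       fallback = fallback
firstUnseen (l ∷ ls) (b ∷ bs) fallback = if b then firstUnseen ls bs fallback else l

firstUnseen-map : ∀ {n t} (p : Fin n → Bool) (ls : Vec (Fin n) t) fallback →
  T (p (firstUnseen ls (map p ls) fallback)) → T (allᵇ p (fallback ∷ ls))
firstUnseen-map p []       fallback pf = subst T (sym (Bool.∧-identityʳ (p fallback))) pf
firstUnseen-map p (l ∷ ls) fallback pf with p l in pl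
... | true  = firstUnseen-map p ls fallback pf
... | false = ⊥-elim (subst T pl pf)

module MissingItemFinder {n t : ℕ} {R : Set} (labels : R → Vec (Fin n) (suc t)) where
  fallback : R → Fin n
  fallback = head ∘ labels

  candidates : R → Vec (Fin n) t
  candidates = tail ∘ labels

  finder : StreamAlg n t R
  finder = record
    { init = λ ω → encodeBits (replicate t false)
    ; step = λ ω σ a → encodeBits (markSeen a (candidates ω) (decodeBits σ))
    ; out  = λ ω σ → firstUnseen (candidates ω) (decodeBits σ) (fallback ω)
    }

  flags-after : ∀ ω (p : Fin n → Bool) {m} (xs : Vec (Fin n) m) →
    decodeBits (foldl _ (step finder ω) (encodeBits (map p (candidates ω))) xs)
      ≡ map (λ l → p l ∨ l ∈ᵇ xs) (candidates ω)
  flags-after ω p [] = trans (decodeBits-encodeBits _) (Vec.map-cong (sym ∘ Bool.∨-identityʳ ∘ p) _)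
  flags-after ω p (x ∷ xs)
    rewrite decodeBits-encodeBits (map p (candidates ω)) | markSeen-map x p (candidates ω)
    = trans (flags-after ω _ xs) (Vec.map-cong (λ l → Bool.∨-assoc (p l) _ _) (candidates ω))

  final-flags : ∀ ω {m} (xs : Vec (Fin n) m) →
    decodeBits (finalState finder ω xs) ≡ map (_∈ᵇ xs) (candidates ω)
  final-flags ω xs rewrite sym (Vec.map-const (candidates ω) false) = flags-after ω (const false) xs

  failure⇒all-seen : ∀ ω {m} (xs : Vec (Fin n) m) →
    T (output finder ω xs ∈ᵇ xs) → T (allᵇ (_∈ᵇ xs) (fallback ω ∷ candidates ω))
  failure⇒all-seen ω xs fails = firstUnseen-map (_∈ᵇ xs) (candidates ω) (fallback ω)
    (subst (λ bs → T (firstUnseen (candidates ω) bs (fallback ω) ∈ᵇ xs)) (final-flags ω xs) fails)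

open MissingItemFinder using (finder)

-- head (labels ω) ∷ tail (labels ω) is not definitionally labels ω (Vec has no η),
-- but it is for the concrete labellings below.
failCount-finder : ∀ {n t k} (labels : Fin (suc k) → Vec (Fin n) (suc t)) {m} (xs : Vec (Fin n) m) →
  failCount (finder labels) xs ≤ count (suc k) (λ ω → allᵇ (_∈ᵇ xs) (head (labels ω) ∷ tail (labels ω)))
failCount-finder labels xs = ℕ.≤-trans
  (ℕ.≤-reflexive (length-filter-tabulate fails? _ (λ ω → ω)))
  (count-mono (λ ω → MissingItemFinder.failure⇒all-seen labels ω xs))
  where
  fails? : ∀ ω → Dec (output (finder labels) ω xs ∈ xs)
  fails? ω = DecMembership._∈?_ _≟_ (output (finder labels) ω xs) xs

distinctLabels : ∀ {n r} → r < n → Vec (Fin n) (suc r)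
distinctLabels r<n = tabulate (λ i → inject≤ i r<n)

uniformLabels : ∀ {n k} t → suc k ≡ n ^ suc t → Fin (suc k) → Vec (Fin n) (suc t)
uniformLabels t k+1≡n^t+1 = decode (suc t) ∘ subst Fin k+1≡n^t+1

failCount-distinct : ∀ {n r} (r<n : r < n) (xs : Vec (Fin n) r) →
  failCount (finder {R = Fin 1} (const (distinctLabels r<n))) xs ≡ 0
failCount-distinct r<n xs =
  ℕ.n≤0⇒n≡0 (ℕ.≤-trans (failCount-finder (const (distinctLabels r<n)) xs) (count-mono {1} all-seen⇒⊥))
  where
  all-seen⇒⊥ : ∀ ω → T (allᵇ (_∈ᵇ xs) (distinctLabels r<n)) → T false
  all-seen⇒⊥ _ all-seen = injective⇒⊈ _ (Fin.inject≤-injective r<n r<n _ _) xs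
    (∈ᵇ⇒∈ ∘ T-allᵇ-tabulate (_∈ᵇ xs) _ all-seen)

failCount-uniform : ∀ {n k} t (k+1≡n^t+1 : suc k ≡ n ^ suc t) {r} (xs : Vec (Fin n) r) →
  failCount (finder (uniformLabels t k+1≡n^t+1)) xs ≤ r ^ suc t
failCount-uniform {n} t k+1≡n^t+1 {r} xs = begin
  failCount (finder (uniformLabels t k+1≡n^t+1)) xs
    ≤⟨ failCount-finder (uniformLabels t k+1≡n^t+1) xs ⟩
  count _ (allᵇ (_∈ᵇ xs) ∘ decode (suc t) ∘ subst Fin k+1≡n^t+1)
    ≡⟨ count-subst k+1≡n^t+1 (allᵇ (_∈ᵇ xs) ∘ decode (suc t)) ⟩
  count (n ^ suc t) (allᵇ (_∈ᵇ xs) ∘ decode (suc t))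
    ≡⟨ count-allᵇ-decode n (suc t) (_∈ᵇ xs) ⟩
  count n (_∈ᵇ xs) ^ suc t
    ≤⟨ ℕ.^-monoˡ-≤ (suc t) (count-∈ xs) ⟩
  r ^ suc t
    ∎
  where open ℕ.≤-Reasoning

frequency-≤ : ∀ {c R k} (δ : ℚ) → c ≤ R → (+ R) / 1 <ℚ δ *ℚ ((+ suc k) / 1) → (+ c) / suc k ≤ℚ δ
frequency-≤ {c} {R} {k} δ@(mkℚ a e _) c≤R R<δ[k+1] =
  ℚ.toℚᵘ-cancel-≤ (ℚᵘ.≤-respˡ-≃ (ℚᵘ.≃-sym (ℚ.toℚᵘ-fromℚᵘ (mkℚᵘ (+ c) k))) (*≤* c[e+1]≤a[k+1]))
  where
  R<δ[k+1]ᵘ : mkℚᵘ (+ R) 0 <ᵘ mkℚᵘ a e *ᵘ mkℚᵘ (+ suc k) 0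
  R<δ[k+1]ᵘ = ℚᵘ.<-respˡ-≃ (ℚ.toℚᵘ-fromℚᵘ (mkℚᵘ (+ R) 0))
    (ℚᵘ.<-respʳ-≃ (ℚᵘ.≃-trans (ℚ.toℚᵘ-homo-* δ ((+ suc k) / 1))
                              (ℚᵘ.*-congˡ {mkℚᵘ a e} (ℚ.toℚᵘ-fromℚᵘ (mkℚᵘ (+ suc k) 0))))
      (ℚ.toℚᵘ-mono-< R<δ[k+1]))
  -- with δ = a / (e + 1): c (e + 1) ≤ R (e + 1) < a (k + 1)
  c[e+1]≤a[k+1] : + c ℤ.* + suc e ℤ.≤ a ℤ.* + suc k
  c[e+1]≤a[k+1] = begin
    + c ℤ.* + suc e           ≡⟨ ℤ.pos-* c (suc e) ⟨
    + (c * suc e)             ≤⟨ ℤ.+≤+ (ℕ.*-monoˡ-≤ (suc e) c≤R) ⟩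
    + (R * suc e)             ≡⟨ cong (λ d → + (R * suc d)) (ℕ.*-identityʳ e) ⟨
    + (R * suc (e * 1))       ≡⟨ ℤ.pos-* R (suc (e * 1)) ⟩
    + R ℤ.* + suc (e * 1)     <⟨ ℚᵘ.drop-*<* R<δ[k+1]ᵘ ⟩
    (a ℤ.* + suc k) ℤ.* + 1   ≡⟨ ℤ.*-identityʳ _ ⟩
    a ℤ.* + suc k             ∎
    where open ℤ.≤-Reasoning

search-up : ∀ {p} {P : ℕ → Set p} → (∀ s → Dec (P s)) → P 0 → ∀ r →
  Σ ℕ λ s → s ≤ r × P s × (s ≡ r ⊎ ¬ P (suc s))
search-up P? P0 zero = 0 , z≤n , P0 , inj₁ refl
search-up P? P0 (suc r) with search-up P? P0 r
... | s , s≤r , Ps , inj₂ ¬Ps+1 = s , ℕ.m≤n⇒m≤1+n s≤r , Ps , inj₂ ¬Ps+1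
... | s , s≤r , Ps , inj₁ refl with P? (suc s)
...   | yes Ps+1 = suc s , ℕ.≤-refl , Ps+1 , inj₁ refl
...   | no ¬Ps+1 = s , ℕ.n≤1+n s , Ps , inj₂ ¬Ps+1

SpaceBound : (n r : ℕ) → ℚ → ℕ → Set
SpaceBound n r δ s = δ *ℚ ((+ (n ^ s)) / 1) ≤ℚ (+ (r ^ s)) / 1

Solution : (n r : ℕ) → ℚ → ℕ → Set
Solution n r δ s = Σ ℕ λ k → Σ (StreamAlg n s (Fin (suc k))) λ A →
  (s ≤ r) × SpaceBound n r δ s × (suc k ≤ n ^ (1 * (s + 1))) × ((xs : Vec (Fin n) r) → errorProb A xs ≤ℚ δ)

SpaceBound? : ∀ n r δ s → Dec (SpaceBound n r δ s)
SpaceBound? n r δ s = δ *ℚ ((+ (n ^ s)) / 1) ℚ.≤? (+ (r ^ s)) / 1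

SpaceBound-0 : ∀ {n r δ} → δ <ℚ 1ℚ → SpaceBound n r δ 0
SpaceBound-0 {δ = δ} δ<1 = subst (_≤ℚ 1ℚ) (sym (ℚ.*-identityʳ δ)) (ℚ.<⇒≤ δ<1)

distinct-solution : ∀ {n r δ} → r < n → 0ℚ <ℚ δ → SpaceBound n r δ r → Solution n r δ r
distinct-solution {n} {r} r<n 0<δ bound =
  0 , finder (const (distinctLabels r<n)) , ℕ.≤-refl , bound , ℕ.m^n>0 n {{n≢0}} (1 * (r + 1)) ,
  λ xs → subst (λ c → (+ c) / 1 ≤ℚ _) (sym (failCount-distinct r<n xs)) (ℚ.<⇒≤ 0<δ)
  where
  n≢0 : NonZero n
  n≢0 = ≢-nonZero (ℕ.m<n⇒n≢0 r<n)

uniform-solution : ∀ {n r δ s} .{{_ : NonZero n}} →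
  s ≤ r → SpaceBound n r δ s → ¬ SpaceBound n r δ (suc s) → Solution n r δ s
uniform-solution {n} {r} {δ} {s} s≤r bound ¬bound[s+1] =
  pred (n ^ suc s) , finder (uniformLabels s k+1≡n^s+1) , s≤r , bound , ℕ.≤-reflexive k+1≡n^C[s+1] ,
  λ xs → frequency-≤ δ (failCount-uniform s k+1≡n^s+1 xs) r^[s+1]<δ[k+1]
  where
  instance
    n^[s+1]≢0 : NonZero (n ^ suc s)
    n^[s+1]≢0 = ℕ.m^n≢0 n (suc s)
  k+1≡n^s+1 : suc (pred (n ^ suc s)) ≡ n ^ suc s
  k+1≡n^s+1 = ℕ.suc-pred (n ^ suc s)
  k+1≡n^C[s+1] : suc (pred (n ^ suc s)) ≡ n ^ (1 * (s + 1))
  k+1≡n^C[s+1] = trans k+1≡n^s+1 (cong (n ^_) (sym (trans (ℕ.*-identityˡ (s + 1)) (ℕ.+-comm s 1))))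
  r^[s+1]<δ[k+1] : (+ (r ^ suc s)) / 1 <ℚ δ *ℚ ((+ suc (pred (n ^ suc s))) / 1)
  r^[s+1]<δ[k+1] = subst (λ m → (+ (r ^ suc s)) / 1 <ℚ δ *ℚ ((+ m) / 1)) (sym k+1≡n^s+1) (ℚ.≰⇒> ¬bound[s+1])

mif-solution : ∀ n r → r < n → ∀ δ → 0ℚ <ℚ δ → δ <ℚ 1ℚ → Σ ℕ (Solution n r δ)
mif-solution n r r<n δ 0<δ δ<1 with search-up (SpaceBound? n r δ) (SpaceBound-0 {n} {r} δ<1) r
... | r , _   , bound , inj₁ refl      = r , distinct-solution r<n 0<δ bound
... | s , s≤r , bound , inj₂ ¬bound[s+1] =
  s , uniform-solution {{≢-nonZero (ℕ.m<n⇒n≢0 r<n)}} s≤r bound ¬bound[s+1]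

theorem2 : Σ ℕ λ C →
    (n r : ℕ) → 0 < r → r < n →
    (δ : ℚ) → 0ℚ <ℚ δ → δ <ℚ 1ℚ →
    Σ ℕ λ s → Σ ℕ λ k → Σ (StreamAlg n s (Fin (suc k))) λ A →
      -- space bound: s ≤ r and s ≤ log(1/δ)/log(n/r), i.e. δ·(n/r)^s ≤ 1
      (s ≤ r) × (δ *ℚ ((+ (n ^ s)) / 1) ≤ℚ (+ (r ^ s)) / 1) ×
      -- randomness: log₂|R| ≤ C·(s+1)·log₂ n random bits
      (suc k ≤ n ^ (C * (s + 1))) ×
      -- error at most δ on every fixed input stream
      ((xs : Vec (Fin n) r) → errorProb A xs ≤ℚ δ)
theorem2 = 1 , λ n r _ → mif-solution n r
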